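{- For $\mu\in(0,1)$ consider the Markov chain $(\sigma_j)_{j\ge0}$ on $\{0,1\}$ with $\sigma_0=0$ and $P(0\to1)=P(1\to0)=(1-\mu)/2$, and define \[d_m=\frac{\mathrm{Var}(\sigma_m)+2\sum_{j=1}^{m-1}\mathrm{Cov}(\sigma_j,\sigma_m)}{\mathrm E[\sigma_m]}\quad(m\ge1).\] Then $d_{L+1}$ is strictly increasing in $L\ge0$, with $d_{L+2}-d_{L+1}=\mu^{L+1}(1+\mu)/2>0$, and $d_{L+1}\to D_\infty(\mu)=\frac{1+\mu}{2(1-\mu)}$ from below as $L\to\infty$.
   Context: This is the state chain of a symmetric stateful digit-wise operation ($|\mathrm{GEN}|=|\mathrm{KILL}|$, $\mu=|\mathrm{PROP}|/N$) with uniformly random symbols started at $0$; $d_m$ is called the marginal dispersion.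
   Formalization: The parameter μ ranges only over the rationals in (0,1). -}

module Defs where

open import Data.Bool using (Bool; true; false; if_then_else_)
open import Data.Nat as ℕ using (ℕ; zero; suc)
open import Data.List using (List; []; _∷_; [_]; _++_; map; foldr)
open import Data.Rational hiding (truncate)
open import Data.Rational.Properties using (_≟_)
open import Relation.Nullary using (yes; no)

2ℚ : ℚ
2ℚ = 1ℚ + 1ℚ

sumℚ : List ℚ → ℚ
sumℚ = foldr _+_ 0ℚ

-- Total division on ℚ (x / 0 := 0); only ever applied to nonzero denominators here.
divℚ : ℚ → ℚ → ℚ
divℚ p q with q ≟ 0ℚ
... | yes _ = 0ℚ
... | no q≢0 = p ÷ q
  where instance _ = ≢-nonZero q≢0

powℚ : ℚ → ℕ → ℚ
powℚ x zero    = 1ℚ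
powℚ x (suc n) = x * powℚ x n

ι : Bool → ℚ
ι false = 0ℚ
ι true  = 1ℚ

trans : ℚ → Bool → Bool → ℚ
trans μ false false = (1ℚ + μ) * ½
trans μ false true  = (1ℚ - μ) * ½
trans μ true  false = (1ℚ - μ) * ½
trans μ true  true  = (1ℚ + μ) * ½

-- probability of the trajectory (σ₁,…,σₘ) = bs given the current state
pathProb : ℚ → Bool → List Bool → ℚ
pathProb μ prev []       = 1ℚ
pathProb μ prev (b ∷ bs) = trans μ prev b * pathProb μ b bs

allPaths : ℕ → List (List Bool)
allPaths zero    = [ [] ]
allPaths (suc m) = map (false ∷_) (allPaths m) ++ map (true ∷_) (allPaths m)

-- σ_j as a function of the trajectory (σ₀ = 0)
state : ℕ → List Bool → Bool
state zero          _        = false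
state (suc j)       []       = false
state (suc zero)    (b ∷ bs) = b
state (suc (suc j)) (b ∷ bs) = state (suc j) bs

σ : ℕ → List Bool → ℚ
σ j bs = ι (state j bs)

E : ℚ → ℕ → (List Bool → ℚ) → ℚ
E μ m f = sumℚ (map (λ bs → pathProb μ false bs * f bs) (allPaths m))

Var : ℚ → ℕ → (List Bool → ℚ) → ℚ
Var μ m X = E μ m (λ bs → X bs * X bs) - E μ m X * E μ m X

Cov : ℚ → ℕ → (List Bool → ℚ) → (List Bool → ℚ) → ℚ
Cov μ m X Y = E μ m (λ bs → X bs * Y bs) - E μ m X * E μ m Y

sumFrom1 : ℕ → (ℕ → ℚ) → ℚ
sumFrom1 zero    f = 0ℚ
sumFrom1 (suc n) f = sumFrom1 n f + f (suc n)

d : ℚ → ℕ → ℚ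
d μ m = divℚ (Var μ m (σ m) + 2ℚ * sumFrom1 (m ℕ.∸ 1) (λ j → Cov μ m (σ j) (σ m)))
             (E μ m (σ m))

D∞ : ℚ → ℚ
D∞ μ = divℚ (1ℚ + μ) (2ℚ * (1ℚ - μ))

{-# OPTIONS --safe #-}
-- Started at 0, the chain has P(σ_j = 1) = (1 - μ^j)/2, and by the Markov property
-- E[σ_j σ_{j+g}] = P(σ_j = 1) (1 + μ^g)/2, so Cov(σ_j, σ_m) = (μ^(m-j) - μ^m μ^j)/4.
-- Summing these as geometric series gives the closed form
--   d_{L+1} = (1 + μ^{L+1})/2 + (μ + ⋯ + μ^L) = D∞ (1 - μ^{L+1}),
-- from which every claim follows; for the limit, Bernoulli's inequality
-- μ^n (1 + n(1 - μ)) ≤ 1 and the Archimedean property of ℚ make μ^n small.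
module Submission where

open import Defs
open import Data.Bool using (Bool; true; false)
open import Data.Integer as ℤ using (+<+; -<+)
open import Data.List using (List; []; _∷_; _++_; map)
open import Data.List.Properties using (map-++; map-cong; map-∘)
open import Data.Nat as ℕ using (ℕ; zero; suc; s≤s)
import Data.Nat.Properties as ℕₚ
open import Data.Product using (_×_; ∃-syntax; _,_; map₂)
open import Data.Rational
  using (ℚ; mkℚ; 0ℚ; 1ℚ; ½; _+_; _-_; _*_; -_; _<_; _≤_; *<*; 1/_; ∣_∣; toℚᵘ; NonZero; positive; nonNegative; ≢-nonZero)
open import Data.Rational.Literals using (fromℤ)
open import Data.Rational.Properties
import Data.Rational.Unnormalised as ℚᵘ
import Data.Rational.Unnormalised.Properties as ℚᵘₚ
open import Data.Rational.Solver using (module +-*-Solver)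
open import Function using (_∘_)
open import Relation.Binary.PropositionalEquality as ≡
  using (_≡_; _≢_; refl; sym; cong; cong₂; subst; subst₂; module ≡-Reasoning)
open import Relation.Nullary using (yes; no; contradiction)

open +-*-Solver

*-pos : ∀ {p q} → 0ℚ < p → 0ℚ < q → 0ℚ < p * q
*-pos {p} {q} 0<p 0<q = positive⁻¹ (p * q) {{pos*pos⇒pos p {{positive 0<p}} q {{positive 0<q}}}}

*-nonNeg : ∀ {p q} → 0ℚ ≤ p → 0ℚ ≤ q → 0ℚ ≤ p * q
*-nonNeg {p} {q} 0≤p 0≤q =
  nonNegative⁻¹ (p * q) {{nonNeg*nonNeg⇒nonNeg p {{nonNegative 0≤p}} q {{nonNegative 0≤q}}}}

p<q⇒0<q-p : ∀ {p q} → p < q → 0ℚ < q - p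
p<q⇒0<q-p {p} {q} p<q = subst (_< q - p) (+-inverseʳ p) (+-monoˡ-< (- p) p<q)

0<q-p⇒p<q : ∀ {p q} → 0ℚ < q - p → p < q
0<q-p⇒p<q {p} {q} 0<q-p = subst₂ _<_ (+-identityˡ p) (q-p+p≡q p q) (+-monoˡ-< p 0<q-p)
  where
  q-p+p≡q : ∀ p q → q - p + p ≡ q
  q-p+p≡q = solve 2 (λ p q → q :- p :+ p := q) refl

p-q<p : ∀ p {q} → 0ℚ < q → p - q < p
p-q<p p 0<q = subst (p - _ <_) (+-identityʳ p) (+-monoʳ-< p (neg-antimono-< 0<q))

*-cancelʳ-≡ : ∀ p q {r} → r ≢ 0ℚ → p * r ≡ q * r → p ≡ q
*-cancelʳ-≡ p q {r} r≢0 pr≡qr = begin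
  p               ≡⟨ sym (p*r*1/r≡p p) ⟩
  p * r * 1/ r    ≡⟨ cong (_* 1/ r) pr≡qr ⟩
  q * r * 1/ r    ≡⟨ p*r*1/r≡p q ⟩
  q               ∎
  where
  open ≡-Reasoning
  instance _ = ≢-nonZero r≢0
  p*r*1/r≡p : ∀ p → p * r * 1/ r ≡ p
  p*r*1/r≡p p = ≡.trans (*-assoc p r (1/ r)) (≡.trans (cong (p *_) (*-inverseʳ r)) (*-identityʳ p))

p*1/q*q≡p : ∀ p q .{{_ : NonZero q}} → p * 1/ q * q ≡ p
p*1/q*q≡p p q = ≡.trans (*-assoc p (1/ q) q) (≡.trans (cong (p *_) (*-inverseˡ q)) (*-identityʳ p))

divℚ[p,q]*q≡p : ∀ p {q} → q ≢ 0ℚ → divℚ p q * q ≡ p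
divℚ[p,q]*q≡p p {q} q≢0 with q ≟ 0ℚ
... | yes q≡0  = contradiction q≡0 q≢0
... | no  q≢0′ = p*1/q*q≡p p q {{≢-nonZero q≢0′}}

powℚ-+ : ∀ x m n → powℚ x (m ℕ.+ n) ≡ powℚ x m * powℚ x n
powℚ-+ x zero    n = sym (*-identityˡ (powℚ x n))
powℚ-+ x (suc m) n = ≡.trans (cong (x *_) (powℚ-+ x m n)) (sym (*-assoc x (powℚ x m) (powℚ x n)))

0<powℚ : ∀ {x} → 0ℚ < x → ∀ n → 0ℚ < powℚ x n
0<powℚ 0<x zero    = positive⁻¹ 1ℚ
0<powℚ 0<x (suc n) = *-pos 0<x (0<powℚ 0<x n)

0≤powℚ : ∀ {x} → 0ℚ ≤ x → ∀ n → 0ℚ ≤ powℚ x n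
0≤powℚ 0≤x zero    = nonNegative⁻¹ 1ℚ
0≤powℚ 0≤x (suc n) = *-nonNeg 0≤x (0≤powℚ 0≤x n)

module _ {x : ℚ} (0≤x : 0ℚ ≤ x) (x≤1 : x ≤ 1ℚ) where

  powℚ-antitone : ∀ {m n} → m ℕ.≤ n → powℚ x n ≤ powℚ x m
  powℚ-antitone = antitone′ ∘ ℕₚ.≤⇒≤′
    where
    antitone′ : ∀ {m n} → m ℕ.≤′ n → powℚ x n ≤ powℚ x m
    antitone′ ℕ.≤′-refl            = ≤-refl
    antitone′ (ℕ.≤′-step {n} m≤′n) = ≤-trans (≤-trans
      (*-monoʳ-≤-nonNeg (powℚ x n) {{nonNegative (0≤powℚ 0≤x n)}} x≤1)
      (≤-reflexive (*-identityˡ (powℚ x n)))) (antitone′ m≤′n)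

  powℚ≤1 : ∀ n → powℚ x n ≤ 1ℚ
  powℚ≤1 n = powℚ-antitone {0} {n} ℕ.z≤n

powℚ-suc<1 : ∀ {x} → 0ℚ ≤ x → x < 1ℚ → ∀ n → powℚ x (suc n) < 1ℚ
powℚ-suc<1 {x} 0≤x x<1 n = ≤-<-trans (powℚ-antitone 0≤x (<⇒≤ x<1) {1} {suc n} (s≤s ℕ.z≤n))
                                      (subst (_< 1ℚ) (sym (*-identityʳ x)) x<1)

sumℚ-++ : ∀ xs ys → sumℚ (xs ++ ys) ≡ sumℚ xs + sumℚ ys
sumℚ-++ []       ys = sym (+-identityˡ (sumℚ ys))
sumℚ-++ (x ∷ xs) ys = ≡.trans (cong (x +_) (sumℚ-++ xs ys)) (sym (+-assoc x (sumℚ xs) (sumℚ ys)))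

sumℚ-map-*ˡ : ∀ {A : Set} c (f : A → ℚ) xs → sumℚ (map (λ a → c * f a) xs) ≡ c * sumℚ (map f xs)
sumℚ-map-*ˡ c f []       = sym (*-zeroʳ c)
sumℚ-map-*ˡ c f (a ∷ xs) =
  ≡.trans (cong (c * f a +_) (sumℚ-map-*ˡ c f xs)) (sym (*-distribˡ-+ c (f a) (sumℚ (map f xs))))

sumFrom1-cong : ∀ n {f g : ℕ → ℚ} → (∀ {j} → j ℕ.≤ n → f j ≡ g j) → sumFrom1 n f ≡ sumFrom1 n g
sumFrom1-cong zero    f≡g = refl
sumFrom1-cong (suc n) f≡g = cong₂ _+_ (sumFrom1-cong n (f≡g ∘ ℕₚ.m≤n⇒m≤1+n)) (f≡g ℕₚ.≤-refl)

sumFrom1-linear : ∀ n a b (f g : ℕ → ℚ) →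
                  sumFrom1 n (λ j → a * f j - b * g j) ≡ a * sumFrom1 n f - b * sumFrom1 n g
sumFrom1-linear zero    a b f g = solve 2 (λ a b → con 0ℚ := a :* con 0ℚ :- b :* con 0ℚ) refl a b
sumFrom1-linear (suc n) a b f g =
  ≡.trans (cong (_+ (a * f (suc n) - b * g (suc n))) (sumFrom1-linear n a b f g))
          (regroup a b (sumFrom1 n f) (sumFrom1 n g) (f (suc n)) (g (suc n)))
  where
  regroup : ∀ a b F G y z → a * F - b * G + (a * y - b * z) ≡ a * (F + y) - b * (G + z)
  regroup = solve 6 (λ a b F G y z → a :* F :- b :* G :+ (a :* y :- b :* z) := a :* (F :+ y) :- b :* (G :+ z)) refl

sumFrom1-suc : ∀ n f → sumFrom1 (suc n) f ≡ f 1 + sumFrom1 n (f ∘ suc)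
sumFrom1-suc zero    f = +-comm 0ℚ (f 1)
sumFrom1-suc (suc n) f = ≡.trans (cong (_+ f (suc (suc n))) (sumFrom1-suc n f))
                                 (+-assoc (f 1) (sumFrom1 n (f ∘ suc)) (f (suc (suc n))))

sumFrom1-reverse : ∀ n f → sumFrom1 n (λ j → f (suc n ℕ.∸ j)) ≡ sumFrom1 n f
sumFrom1-reverse zero    f = refl
sumFrom1-reverse (suc n) f = begin
    sumFrom1 n (λ j → f (suc (suc n) ℕ.∸ j)) + f (suc (suc n) ℕ.∸ suc n)
  ≡⟨ cong₂ _+_ (sumFrom1-cong n (cong f ∘ ℕₚ.+-∸-assoc 1 ∘ ℕₚ.m≤n⇒m≤1+n))
               (cong f (ℕₚ.m+n∸n≡m 1 n)) ⟩
    sumFrom1 n (λ j → f (suc (suc n ℕ.∸ j))) + f 1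
  ≡⟨ cong (_+ f 1) (sumFrom1-reverse n (f ∘ suc)) ⟩
    sumFrom1 n (f ∘ suc) + f 1
  ≡⟨ +-comm _ (f 1) ⟩
    f 1 + sumFrom1 n (f ∘ suc)
  ≡⟨ sym (sumFrom1-suc n f) ⟩
    sumFrom1 (suc n) f
  ∎
  where open ≡-Reasoning

geometric-sum : ∀ x n → (1ℚ - x) * sumFrom1 n (powℚ x) ≡ x - powℚ x (suc n)
geometric-sum x zero    = solve 1 (λ x → (con 1ℚ :- x) :* con 0ℚ := x :- x :* con 1ℚ) refl x
geometric-sum x (suc n) = begin
    (1ℚ - x) * (sumFrom1 n (powℚ x) + powℚ x (suc n))
  ≡⟨ *-distribˡ-+ (1ℚ - x) _ _ ⟩
    (1ℚ - x) * sumFrom1 n (powℚ x) + (1ℚ - x) * powℚ x (suc n)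
  ≡⟨ cong (_+ (1ℚ - x) * powℚ x (suc n)) (geometric-sum x n) ⟩
    x - powℚ x (suc n) + (1ℚ - x) * powℚ x (suc n)
  ≡⟨ solve 2 (λ x P → x :- P :+ (con 1ℚ :- x) :* P := x :- x :* P) refl x (powℚ x (suc n)) ⟩
    x - x * powℚ x (suc n)
  ∎
  where open ≡-Reasoning

fromℕ : ℕ → ℚ
fromℕ n = fromℤ (ℤ.+ n)

fromℕ-suc : ∀ n → fromℕ (suc n) ≡ 1ℚ + fromℕ n
fromℕ-suc n = toℚᵘ-injective (ℚᵘₚ.≃-trans (ℚᵘ.*≡* (cross-multiplied n)) (ℚᵘₚ.≃-sym (toℚᵘ-homo-+ 1ℚ (fromℕ n))))
  where
  cross-multiplied : ∀ n → ℚᵘ.↥ toℚᵘ (fromℕ (suc n)) ℤ.* ℚᵘ.↧ (toℚᵘ 1ℚ ℚᵘ.+ toℚᵘ (fromℕ n))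
                   ≡ ℚᵘ.↥ (toℚᵘ 1ℚ ℚᵘ.+ toℚᵘ (fromℕ n)) ℤ.* ℚᵘ.↧ toℚᵘ (fromℕ (suc n))
  cross-multiplied zero    = refl
  cross-multiplied (suc n) = cong (λ k → ℤ.+ suc (suc k)) (sym (ℕₚ.*-identityʳ (n ℕ.* 1)))

archimedean : ∀ x {r} → 0ℚ < r → ∃[ k ] x < fromℕ k * r
archimedean x {r} 0<r = map₂ scale (archimedean-ℕ (x * 1/ r))
  where
  instance _ = pos⇒nonZero r {{positive 0<r}}
  archimedean-ℕ : ∀ y → ∃[ k ] y < fromℕ k
  archimedean-ℕ (mkℚ (ℤ.+ zero) _ _)      = 1 , *<* (+<+ (s≤s ℕ.z≤n))
  archimedean-ℕ (mkℚ (ℤ.+ a@(suc _)) d _) = suc a , *<* (+<+ (subst (ℕ._< suc a ℕ.* suc d)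
    (sym (ℕₚ.*-identityʳ a)) (ℕₚ.<-≤-trans (ℕₚ.n<1+n a) (ℕₚ.m≤m*n (suc a) (suc d)))))
  archimedean-ℕ (mkℚ ℤ.-[1+ _ ] _ _)      = 0 , *<* -<+
  scale : ∀ {k} → x * 1/ r < fromℕ k → x < fromℕ k * r
  scale {k} x/r<k = subst (_< fromℕ k * r) (p*1/q*q≡p x r) (*-monoˡ-<-pos r {{positive 0<r}} x/r<k)

bernoulli : ∀ {x} → 0ℚ ≤ x → x ≤ 1ℚ → ∀ n → powℚ x n * (1ℚ + fromℕ n * (1ℚ - x)) ≤ 1ℚ
bernoulli {x} 0≤x x≤1 zero    = ≤-reflexive (solve 1 (λ x → con 1ℚ :* (con 1ℚ :+ con 0ℚ :* (con 1ℚ :- x)) := con 1ℚ) refl x)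
bernoulli {x} 0≤x x≤1 (suc n) = begin
    powℚ x (suc n) * (1ℚ + fromℕ (suc n) * (1ℚ - x))
  ≡⟨ cong (λ k → powℚ x (suc n) * (1ℚ + k * (1ℚ - x))) (fromℕ-suc n) ⟩
    powℚ x (suc n) * (1ℚ + (1ℚ + fromℕ n) * (1ℚ - x))
  ≡⟨ solve 3 (λ x P k → x :* P :* (con 1ℚ :+ (con 1ℚ :+ k) :* (con 1ℚ :- x))
                     := x :* (P :* (con 1ℚ :+ k :* (con 1ℚ :- x))) :+ x :* P :* (con 1ℚ :- x)) refl x (powℚ x n) (fromℕ n) ⟩
    x * (powℚ x n * (1ℚ + fromℕ n * (1ℚ - x))) + powℚ x (suc n) * (1ℚ - x)
  ≤⟨ +-mono-≤ (*-monoˡ-≤-nonNeg x {{nonNegative 0≤x}} (bernoulli 0≤x x≤1 n))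
              (*-monoʳ-≤-nonNeg (1ℚ - x) {{nonNegative 0≤1-x}} (powℚ≤1 0≤x x≤1 (suc n))) ⟩
    x * 1ℚ + 1ℚ * (1ℚ - x)
  ≡⟨ solve 1 (λ x → x :* con 1ℚ :+ con 1ℚ :* (con 1ℚ :- x) := con 1ℚ) refl x ⟩
    1ℚ
  ∎
  where
  open ≤-Reasoning
  0≤1-x : 0ℚ ≤ 1ℚ - x
  0≤1-x = subst (_≤ 1ℚ - x) (+-inverseʳ x) (+-monoˡ-≤ (- x) x≤1)

*-powℚ→0 : ∀ {x c ε} → 0ℚ ≤ x → x < 1ℚ → 0ℚ ≤ c → 0ℚ < ε → ∃[ N ] (∀ n → N ℕ.≤ n → c * powℚ x n < ε)
*-powℚ→0 {x} {c} {ε} 0≤x x<1 0≤c 0<ε = map₂ eventually (archimedean c (*-pos 0<ε 0<1-x))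
  where
  0<1-x : 0ℚ < 1ℚ - x
  0<1-x = p<q⇒0<q-p x<1
  -- Multiplying by w = k(1 - x) turns Bernoulli's inequality into c xᵏ w ≤ c < ε w.
  eventually : ∀ {k} → c < fromℕ k * (ε * (1ℚ - x)) → ∀ n → k ℕ.≤ n → c * powℚ x n < ε
  eventually {k} c<kε[1-x] n k≤n = ≤-<-trans
    (*-monoˡ-≤-nonNeg c {{nonNegative 0≤c}} (powℚ-antitone 0≤x (<⇒≤ x<1) k≤n))
    (*-cancelʳ-<-nonNeg w {{nonNegative 0≤w}} (begin-strict
      c * powℚ x k * w           ≡⟨ *-assoc c (powℚ x k) w ⟩
      c * (powℚ x k * w)         ≤⟨ *-monoˡ-≤-nonNeg c {{nonNegative 0≤c}} xᵏw≤1 ⟩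
      c * 1ℚ                     ≡⟨ *-identityʳ c ⟩
      c                          <⟨ c<kε[1-x] ⟩
      fromℕ k * (ε * (1ℚ - x))   ≡⟨ solve 3 (λ k ε y → k :* (ε :* y) := ε :* (k :* y)) refl (fromℕ k) ε (1ℚ - x) ⟩
      ε * w                      ∎))
    where
    open ≤-Reasoning
    w : ℚ
    w = fromℕ k * (1ℚ - x)
    0≤w : 0ℚ ≤ w
    0≤w = *-nonNeg (nonNegative⁻¹ (fromℕ k)) (<⇒≤ 0<1-x)
    xᵏw≤1 : powℚ x k * w ≤ 1ℚ
    xᵏw≤1 = ≤-trans (*-monoˡ-≤-nonNeg (powℚ x k) {{nonNegative (0≤powℚ 0≤x k)}}
                      (subst (_≤ 1ℚ + w) (+-identityˡ w) (+-monoˡ-≤ w (nonNegative⁻¹ 1ℚ))))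
                    (bernoulli 0≤x (<⇒≤ x<1) k)

-- `state` for an arbitrary initial state, so that a trajectory can be consumed from the front.
stateFrom : Bool → ℕ → List Bool → Bool
stateFrom s zero    bs       = s
stateFrom s (suc j) []       = false
stateFrom s (suc j) (b ∷ bs) = stateFrom b j bs

state-suc≡stateFrom : ∀ s j bs → state (suc j) bs ≡ stateFrom s (suc j) bs
state-suc≡stateFrom s j       []       = refl
state-suc≡stateFrom s zero    (b ∷ bs) = refl
state-suc≡stateFrom s (suc j) (b ∷ bs) = state-suc≡stateFrom b j bs

state≡stateFrom : ∀ j bs → state j bs ≡ stateFrom false j bs
state≡stateFrom zero    bs = refl
state≡stateFrom (suc j) bs = state-suc≡stateFrom false j bs

ι-idem : ∀ b → ι b * ι b ≡ ι b
ι-idem false = refl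
ι-idem true  = refl

¼ : ℚ
¼ = ½ * ½

module _ (μ : ℚ) where

  Eₛ : Bool → ℕ → (List Bool → ℚ) → ℚ
  Eₛ s m f = sumℚ (map (λ bs → pathProb μ s bs * f bs) (allPaths m))

  next : Bool → (Bool → ℚ) → ℚ
  next s g = trans μ s false * g false + trans μ s true * g true

  next-cong : ∀ s {g h : Bool → ℚ} → (∀ b → g b ≡ h b) → next s g ≡ next s h
  next-cong s g≡h = cong₂ (λ u v → trans μ s false * u + trans μ s true * v) (g≡h false) (g≡h true)

  next-const : ∀ s c → next s (λ _ → c) ≡ c
  next-const false c = solve 2 (λ μ c → (con 1ℚ :+ μ) :* con ½ :* c :+ (con 1ℚ :- μ) :* con ½ :* c := c) refl μ c
  next-const true  c = solve 2 (λ μ c → (con 1ℚ :- μ) :* con ½ :* c :+ (con 1ℚ :+ μ) :* con ½ :* c := c) refl μ c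

  next-*ʳ : ∀ s g c → next s g * c ≡ next s (λ b → g b * c)
  next-*ʳ s g c = solve 5 (λ a b u v c → (a :* u :+ b :* v) :* c := a :* (u :* c) :+ b :* (v :* c)) refl
                          (trans μ s false) (trans μ s true) (g false) (g true) c

  Eₛ-cong : ∀ s m {f g} → (∀ bs → f bs ≡ g bs) → Eₛ s m f ≡ Eₛ s m g
  Eₛ-cong s m f≡g = cong sumℚ (map-cong (λ bs → cong (pathProb μ s bs *_) (f≡g bs)) (allPaths m))

  Eₛ-*ˡ : ∀ s m c f → Eₛ s m (λ bs → c * f bs) ≡ c * Eₛ s m f
  Eₛ-*ˡ s m c f = ≡.trans (cong sumℚ (map-cong (λ bs → swap (pathProb μ s bs) c (f bs)) (allPaths m)))
                          (sumℚ-map-*ˡ c (λ bs → pathProb μ s bs * f bs) (allPaths m))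
    where
    swap : ∀ p c y → p * (c * y) ≡ c * (p * y)
    swap = solve 3 (λ p c y → p :* (c :* y) := c :* (p :* y)) refl

  Eₛ-suc : ∀ s m f → Eₛ s (suc m) f ≡ next s (λ b → Eₛ b m (λ bs → f (b ∷ bs)))
  Eₛ-suc s m f = begin
      sumℚ (map w (map (false ∷_) P ++ map (true ∷_) P))
    ≡⟨ cong sumℚ (map-++ w (map (false ∷_) P) (map (true ∷_) P)) ⟩
      sumℚ (map w (map (false ∷_) P) ++ map w (map (true ∷_) P))
    ≡⟨ sumℚ-++ (map w (map (false ∷_) P)) (map w (map (true ∷_) P)) ⟩
      sumℚ (map w (map (false ∷_) P)) + sumℚ (map w (map (true ∷_) P))
    ≡⟨ cong₂ _+_ (branch false) (branch true) ⟩
      next s (λ b → Eₛ b m (λ bs → f (b ∷ bs)))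
    ∎
    where
    open ≡-Reasoning
    P : List (List Bool)
    P = allPaths m
    w : List Bool → ℚ
    w bs = pathProb μ s bs * f bs
    branch : ∀ b → sumℚ (map w (map (b ∷_) P)) ≡ trans μ s b * Eₛ b m (λ bs → f (b ∷ bs))
    branch b = begin
        sumℚ (map w (map (b ∷_) P))
      ≡⟨ cong sumℚ (sym (map-∘ P)) ⟩
        sumℚ (map (λ bs → trans μ s b * pathProb μ b bs * f (b ∷ bs)) P)
      ≡⟨ cong sumℚ (map-cong (λ bs → *-assoc (trans μ s b) (pathProb μ b bs) (f (b ∷ bs))) P) ⟩
        sumℚ (map (λ bs → trans μ s b * (pathProb μ b bs * f (b ∷ bs))) P)
      ≡⟨ sumℚ-map-*ˡ (trans μ s b) (λ bs → pathProb μ b bs * f (b ∷ bs)) P ⟩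
        trans μ s b * Eₛ b m (λ bs → f (b ∷ bs))
      ∎

  Eₛ-const : ∀ s m c → Eₛ s m (λ _ → c) ≡ c
  Eₛ-const s zero    c = ≡.trans (+-identityʳ (1ℚ * c)) (*-identityˡ c)
  Eₛ-const s (suc m) c = ≡.trans (Eₛ-suc s m (λ _ → c))
                                 (≡.trans (next-cong s (λ b → Eₛ-const b m c)) (next-const s c))

  -- P(σ_j = 1) for the chain started at s
  p₁ : Bool → ℕ → ℚ
  p₁ false j = (1ℚ - powℚ μ j) * ½
  p₁ true  j = (1ℚ + powℚ μ j) * ½

  next-p₁ : ∀ s j → next s (λ b → p₁ b j) ≡ p₁ s (suc j)
  next-p₁ false j = solve 2 (λ μ P → (con 1ℚ :+ μ) :* con ½ :* ((con 1ℚ :- P) :* con ½)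
                                   :+ (con 1ℚ :- μ) :* con ½ :* ((con 1ℚ :+ P) :* con ½)
                                  := (con 1ℚ :- μ :* P) :* con ½) refl μ (powℚ μ j)
  next-p₁ true  j = solve 2 (λ μ P → (con 1ℚ :- μ) :* con ½ :* ((con 1ℚ :- P) :* con ½)
                                   :+ (con 1ℚ :+ μ) :* con ½ :* ((con 1ℚ :+ P) :* con ½)
                                  := (con 1ℚ :+ μ :* P) :* con ½) refl μ (powℚ μ j)

  Eₛ-σ : ∀ s j m → j ℕ.≤ m → Eₛ s m (λ bs → ι (stateFrom s j bs)) ≡ p₁ s j
  Eₛ-σ s zero m _ = ≡.trans (Eₛ-const s m (ι s)) (p₁-zero s)
    where
    p₁-zero : ∀ s → ι s ≡ p₁ s 0
    p₁-zero false = refl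
    p₁-zero true  = refl
  Eₛ-σ s (suc j) (suc m) (s≤s j≤m) = begin
      Eₛ s (suc m) (λ bs → ι (stateFrom s (suc j) bs))
    ≡⟨ Eₛ-suc s m _ ⟩
      next s (λ b → Eₛ b m (λ bs → ι (stateFrom b j bs)))
    ≡⟨ next-cong s (λ b → Eₛ-σ b j m j≤m) ⟩
      next s (λ b → p₁ b j)
    ≡⟨ next-p₁ s j ⟩
      p₁ s (suc j)
    ∎
    where open ≡-Reasoning

  -- Markov property: after j steps the chain restarts from σ_j, and only σ_j = 1 contributes.
  Eₛ-σσ : ∀ s j g m → j ℕ.+ g ℕ.≤ m →
          Eₛ s m (λ bs → ι (stateFrom s j bs) * ι (stateFrom s (j ℕ.+ g) bs)) ≡ p₁ s j * p₁ true g
  Eₛ-σσ s zero g m g≤m = begin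
      Eₛ s m (λ bs → ι s * ι (stateFrom s g bs))
    ≡⟨ Eₛ-*ˡ s m (ι s) _ ⟩
      ι s * Eₛ s m (λ bs → ι (stateFrom s g bs))
    ≡⟨ cong (ι s *_) (Eₛ-σ s g m g≤m) ⟩
      ι s * p₁ s g
    ≡⟨ from-s s ⟩
      p₁ s 0 * p₁ true g
    ∎
    where
    open ≡-Reasoning
    from-s : ∀ s → ι s * p₁ s g ≡ p₁ s 0 * p₁ true g
    from-s false = ≡.trans (*-zeroˡ (p₁ false g)) (sym (*-zeroˡ (p₁ true g)))
    from-s true  = refl
  Eₛ-σσ s (suc j) g (suc m) (s≤s j+g≤m) = begin
      Eₛ s (suc m) (λ bs → ι (stateFrom s (suc j) bs) * ι (stateFrom s (suc j ℕ.+ g) bs))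
    ≡⟨ Eₛ-suc s m _ ⟩
      next s (λ b → Eₛ b m (λ bs → ι (stateFrom b j bs) * ι (stateFrom b (j ℕ.+ g) bs)))
    ≡⟨ next-cong s (λ b → Eₛ-σσ b j g m j+g≤m) ⟩
      next s (λ b → p₁ b j * p₁ true g)
    ≡⟨ sym (next-*ʳ s (λ b → p₁ b j) (p₁ true g)) ⟩
      next s (λ b → p₁ b j) * p₁ true g
    ≡⟨ cong (_* p₁ true g) (next-p₁ s j) ⟩
      p₁ s (suc j) * p₁ true g
    ∎
    where open ≡-Reasoning

  E-σ : ∀ j m → j ℕ.≤ m → E μ m (σ j) ≡ p₁ false j
  E-σ j m j≤m = ≡.trans (Eₛ-cong false m (cong ι ∘ state≡stateFrom j)) (Eₛ-σ false j m j≤m)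

  E-σσ : ∀ j g m → j ℕ.+ g ℕ.≤ m → E μ m (λ bs → σ j bs * σ (j ℕ.+ g) bs) ≡ p₁ false j * p₁ true g
  E-σσ j g m j+g≤m = ≡.trans
    (Eₛ-cong false m (λ bs → cong₂ (λ u v → ι u * ι v) (state≡stateFrom j bs) (state≡stateFrom (j ℕ.+ g) bs)))
    (Eₛ-σσ false j g m j+g≤m)

  Var-σ : ∀ m → Var μ m (σ m) ≡ p₁ false m - p₁ false m * p₁ false m
  Var-σ m = cong₂ _-_ (≡.trans (Eₛ-cong false m (ι-idem ∘ state m)) (E-σ m m ℕₚ.≤-refl))
                      (cong₂ _*_ (E-σ m m ℕₚ.≤-refl) (E-σ m m ℕₚ.≤-refl))

  Cov-σ : ∀ {j m} → j ℕ.≤ m → Cov μ m (σ j) (σ m) ≡ ¼ * powℚ μ (m ℕ.∸ j) - ¼ * powℚ μ m * powℚ μ j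
  Cov-σ {j} {m} j≤m with m ℕ.∸ j | ℕₚ.m+[n∸m]≡n j≤m
  ... | g | refl = begin
      E μ (j ℕ.+ g) (λ bs → σ j bs * σ (j ℕ.+ g) bs) - E μ (j ℕ.+ g) (σ j) * E μ (j ℕ.+ g) (σ (j ℕ.+ g))
    ≡⟨ cong₂ _-_ (E-σσ j g (j ℕ.+ g) ℕₚ.≤-refl)
                 (cong₂ _*_ (E-σ j (j ℕ.+ g) (ℕₚ.m≤m+n j g)) (E-σ (j ℕ.+ g) (j ℕ.+ g) ℕₚ.≤-refl)) ⟩
      p₁ false j * p₁ true g - p₁ false j * p₁ false (j ℕ.+ g)
    ≡⟨ cong (λ z → p₁ false j * p₁ true g - p₁ false j * ((1ℚ - z) * ½)) (powℚ-+ μ j g) ⟩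
      (1ℚ - X) * ½ * ((1ℚ + Y) * ½) - (1ℚ - X) * ½ * ((1ℚ - X * Y) * ½)
    ≡⟨ solve 2 (λ X Y → (con 1ℚ :- X) :* con ½ :* ((con 1ℚ :+ Y) :* con ½)
                        :- (con 1ℚ :- X) :* con ½ :* ((con 1ℚ :- X :* Y) :* con ½)
                      := con ¼ :* Y :- con ¼ :* (X :* Y) :* X) refl X Y ⟩
      ¼ * Y - ¼ * (X * Y) * X
    ≡⟨ cong (λ z → ¼ * Y - ¼ * z * X) (sym (powℚ-+ μ j g)) ⟩
      ¼ * Y - ¼ * powℚ μ (j ℕ.+ g) * X
    ∎
    where
    open ≡-Reasoning
    X : ℚ
    X = powℚ μ j
    Y : ℚ
    Y = powℚ μ g

  sum-Cov-σ : ∀ L → sumFrom1 L (λ j → Cov μ (suc L) (σ j) (σ (suc L)))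
                    ≡ ¼ * sumFrom1 L (powℚ μ) - ¼ * powℚ μ (suc L) * sumFrom1 L (powℚ μ)
  sum-Cov-σ L = begin
      sumFrom1 L (λ j → Cov μ (suc L) (σ j) (σ (suc L)))
    ≡⟨ sumFrom1-cong L (Cov-σ ∘ ℕₚ.m≤n⇒m≤1+n) ⟩
      sumFrom1 L (λ j → ¼ * powℚ μ (suc L ℕ.∸ j) - ¼ * powℚ μ (suc L) * powℚ μ j)
    ≡⟨ sumFrom1-linear L ¼ (¼ * powℚ μ (suc L)) (λ j → powℚ μ (suc L ℕ.∸ j)) (powℚ μ) ⟩
      ¼ * sumFrom1 L (λ j → powℚ μ (suc L ℕ.∸ j)) - ¼ * powℚ μ (suc L) * sumFrom1 L (powℚ μ)
    ≡⟨ cong (λ s → ¼ * s - ¼ * powℚ μ (suc L) * sumFrom1 L (powℚ μ)) (sumFrom1-reverse L (powℚ μ)) ⟩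
      ¼ * sumFrom1 L (powℚ μ) - ¼ * powℚ μ (suc L) * sumFrom1 L (powℚ μ)
    ∎
    where open ≡-Reasoning

  d-suc : ∀ L → powℚ μ (suc L) < 1ℚ → d μ (suc L) ≡ (1ℚ + powℚ μ (suc L)) * ½ + sumFrom1 L (powℚ μ)
  d-suc L Z<1 = *-cancelʳ-≡ (d μ (suc L)) _ e≢0 (begin
      d μ (suc L) * e
    ≡⟨ divℚ[p,q]*q≡p _ e≢0 ⟩
      Var μ (suc L) (σ (suc L)) + 2ℚ * sumFrom1 L (λ j → Cov μ (suc L) (σ j) (σ (suc L)))
    ≡⟨ cong₂ (λ v c → v + 2ℚ * c) (Var-σ (suc L)) (sum-Cov-σ L) ⟩
      (1ℚ - Z) * ½ - (1ℚ - Z) * ½ * ((1ℚ - Z) * ½) + 2ℚ * (¼ * S - ¼ * Z * S)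
    ≡⟨ solve 2 (λ Z S → (con 1ℚ :- Z) :* con ½ :- (con 1ℚ :- Z) :* con ½ :* ((con 1ℚ :- Z) :* con ½)
                        :+ con 2ℚ :* (con ¼ :* S :- con ¼ :* Z :* S)
                       := ((con 1ℚ :+ Z) :* con ½ :+ S) :* ((con 1ℚ :- Z) :* con ½)) refl Z S ⟩
      ((1ℚ + Z) * ½ + S) * ((1ℚ - Z) * ½)
    ≡⟨ cong (((1ℚ + Z) * ½ + S) *_) (sym Eσ) ⟩
      ((1ℚ + Z) * ½ + S) * e
    ∎)
    where
    open ≡-Reasoning
    Z : ℚ
    Z = powℚ μ (suc L)
    S : ℚ
    S = sumFrom1 L (powℚ μ)
    e : ℚ
    e = E μ (suc L) (σ (suc L))
    Eσ : e ≡ (1ℚ - Z) * ½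
    Eσ = E-σ (suc L) (suc L) ℕₚ.≤-refl
    e≢0 : e ≢ 0ℚ
    e≢0 = ≡.≢-sym (<⇒≢ (subst (0ℚ <_) (sym Eσ) (*-pos (p<q⇒0<q-p Z<1) (positive⁻¹ ½))))

strictMono-suc : (f : ℕ → ℚ) → (∀ n → f n < f (suc n)) → ∀ {m n} → m ℕ.< n → f m < f n
strictMono-suc f f<f∘suc = go ∘ ℕₚ.<⇒<′
  where
  go : ∀ {m n} → m ℕ.<′ n → f m < f n
  go ℕ.≤′-refl         = f<f∘suc _
  go (ℕ.≤′-step m<′n) = <-trans (go m<′n) (f<f∘suc _)

module Dispersion {μ : ℚ} (0<μ : 0ℚ < μ) (μ<1 : μ < 1ℚ) where

  0<1+μ : 0ℚ < 1ℚ + μ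
  0<1+μ = +-mono-< (positive⁻¹ 1ℚ) 0<μ

  0<2[1-μ] : 0ℚ < 2ℚ * (1ℚ - μ)
  0<2[1-μ] = *-pos (positive⁻¹ 2ℚ) (p<q⇒0<q-p μ<1)

  2[1-μ]≢0 : 2ℚ * (1ℚ - μ) ≢ 0ℚ
  2[1-μ]≢0 = ≡.≢-sym (<⇒≢ 0<2[1-μ])

  D∞*2[1-μ] : D∞ μ * (2ℚ * (1ℚ - μ)) ≡ 1ℚ + μ
  D∞*2[1-μ] = divℚ[p,q]*q≡p (1ℚ + μ) 2[1-μ]≢0

  0<D∞ : 0ℚ < D∞ μ
  0<D∞ = *-cancelʳ-<-nonNeg (2ℚ * (1ℚ - μ)) {{nonNegative (<⇒≤ 0<2[1-μ])}}
           (subst₂ _<_ (sym (*-zeroˡ (2ℚ * (1ℚ - μ)))) (sym D∞*2[1-μ]) 0<1+μ)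

  d-closed : ∀ L → d μ (suc L) ≡ D∞ μ * (1ℚ - powℚ μ (suc L))
  d-closed L = *-cancelʳ-≡ (d μ (suc L)) _ 2[1-μ]≢0 (begin
      d μ (suc L) * (2ℚ * (1ℚ - μ))
    ≡⟨ cong (_* (2ℚ * (1ℚ - μ))) (d-suc μ L (powℚ-suc<1 (<⇒≤ 0<μ) μ<1 L)) ⟩
      ((1ℚ + Z) * ½ + S) * (2ℚ * (1ℚ - μ))
    ≡⟨ solve 3 (λ μ Z S → ((con 1ℚ :+ Z) :* con ½ :+ S) :* (con 2ℚ :* (con 1ℚ :- μ))
                        := (con 1ℚ :+ Z) :* (con 1ℚ :- μ) :+ con 2ℚ :* ((con 1ℚ :- μ) :* S)) refl μ Z S ⟩
      (1ℚ + Z) * (1ℚ - μ) + 2ℚ * ((1ℚ - μ) * S)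
    ≡⟨ cong (λ t → (1ℚ + Z) * (1ℚ - μ) + 2ℚ * t) (geometric-sum μ L) ⟩
      (1ℚ + Z) * (1ℚ - μ) + 2ℚ * (μ - Z)
    ≡⟨ solve 2 (λ μ Z → (con 1ℚ :+ Z) :* (con 1ℚ :- μ) :+ con 2ℚ :* (μ :- Z)
                      := (con 1ℚ :+ μ) :* (con 1ℚ :- Z)) refl μ Z ⟩
      (1ℚ + μ) * (1ℚ - Z)
    ≡⟨ cong (_* (1ℚ - Z)) (sym D∞*2[1-μ]) ⟩
      D∞ μ * (2ℚ * (1ℚ - μ)) * (1ℚ - Z)
    ≡⟨ solve 3 (λ D c y → D :* c :* y := D :* y :* c) refl (D∞ μ) (2ℚ * (1ℚ - μ)) (1ℚ - Z) ⟩
      D∞ μ * (1ℚ - Z) * (2ℚ * (1ℚ - μ))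
    ∎)
    where
    open ≡-Reasoning
    Z : ℚ
    Z = powℚ μ (suc L)
    S : ℚ
    S = sumFrom1 L (powℚ μ)

  d-increment : ∀ L → d μ (suc (suc L)) - d μ (suc L) ≡ powℚ μ (suc L) * (1ℚ + μ) * ½
  d-increment L = begin
      d μ (suc (suc L)) - d μ (suc L)
    ≡⟨ cong₂ _-_ (d-closed (suc L)) (d-closed L) ⟩
      D∞ μ * (1ℚ - μ * Z) - D∞ μ * (1ℚ - Z)
    ≡⟨ solve 3 (λ D μ Z → D :* (con 1ℚ :- μ :* Z) :- D :* (con 1ℚ :- Z)
                        := Z :* (D :* (con 2ℚ :* (con 1ℚ :- μ))) :* con ½) refl (D∞ μ) μ Z ⟩
      Z * (D∞ μ * (2ℚ * (1ℚ - μ))) * ½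
    ≡⟨ cong (λ t → Z * t * ½) D∞*2[1-μ] ⟩
      Z * (1ℚ + μ) * ½
    ∎
    where
    open ≡-Reasoning
    Z : ℚ
    Z = powℚ μ (suc L)

  0<increment : ∀ L → 0ℚ < powℚ μ (suc L) * (1ℚ + μ) * ½
  0<increment L = *-pos (*-pos (0<powℚ 0<μ (suc L)) 0<1+μ) (positive⁻¹ ½)

  d-strictMono : ∀ L L′ → L ℕ.< L′ → d μ (suc L) < d μ (suc L′)
  d-strictMono _ _ = strictMono-suc (d μ ∘ suc) λ L →
    0<q-p⇒p<q (subst (0ℚ <_) (sym (d-increment L)) (0<increment L))

  d<D∞ : ∀ L → d μ (suc L) < D∞ μ
  d<D∞ L = subst₂ _<_ (sym (d-closed L)) (*-identityʳ (D∞ μ))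
             (*-monoʳ-<-pos (D∞ μ) {{positive 0<D∞}} (p-q<p 1ℚ (0<powℚ 0<μ (suc L))))

  ∣d-D∞∣ : ∀ L → ∣ d μ (suc L) - D∞ μ ∣ ≡ D∞ μ * powℚ μ (suc L)
  ∣d-D∞∣ L = begin
      ∣ d μ (suc L) - D∞ μ ∣
    ≡⟨ cong (λ t → ∣ t - D∞ μ ∣) (d-closed L) ⟩
      ∣ D∞ μ * (1ℚ - Z) - D∞ μ ∣
    ≡⟨ cong ∣_∣ (solve 2 (λ D Z → D :* (con 1ℚ :- Z) :- D := :- (D :* Z)) refl (D∞ μ) Z) ⟩
      ∣ - (D∞ μ * Z) ∣
    ≡⟨ ∣-p∣≡∣p∣ (D∞ μ * Z) ⟩
      ∣ D∞ μ * Z ∣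
    ≡⟨ 0≤p⇒∣p∣≡p (<⇒≤ (*-pos 0<D∞ (0<powℚ 0<μ (suc L)))) ⟩
      D∞ μ * Z
    ∎
    where
    open ≡-Reasoning
    Z : ℚ
    Z = powℚ μ (suc L)

  d→D∞ : ∀ ε → 0ℚ < ε → ∃[ N ] (∀ L → N ℕ.≤ L → ∣ d μ (suc L) - D∞ μ ∣ < ε)
  d→D∞ ε 0<ε = map₂ (λ small L N≤L → subst (_< ε) (sym (∣d-D∞∣ L)) (small (suc L) (ℕₚ.m≤n⇒m≤1+n N≤L)))
                    (*-powℚ→0 (<⇒≤ 0<μ) μ<1 (<⇒≤ 0<D∞) 0<ε)

lemma7p8 : (μ : ℚ) → 0ℚ < μ → μ < 1ℚ →
    ((L L′ : ℕ) → L ℕ.< L′ → d μ (suc L) < d μ (suc L′))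
    × ((L : ℕ) → d μ (suc (suc L)) - d μ (suc L) ≡ powℚ μ (suc L) * (1ℚ + μ) * ½)
    × ((L : ℕ) → 0ℚ < powℚ μ (suc L) * (1ℚ + μ) * ½)
    × ((L : ℕ) → d μ (suc L) < D∞ μ)
    × ((ε : ℚ) → 0ℚ < ε → ∃[ N ] ((L : ℕ) → N ℕ.≤ L → ∣ d μ (suc L) - D∞ μ ∣ < ε))
lemma7p8 μ 0<μ μ<1 = d-strictMono , d-increment , 0<increment , d<D∞ , d→D∞
  where open Dispersion 0<μ μ<1
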